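{- Let $\mathcal{H}=\bigcup_{i\in[t]}\bigcup_{j\in[\ell_i]}P_{i,j}$ be a coarse ear-decomposition in a graph $G$ of girth at least $5$ such that $\ell_t\ge2$. Then $G-E(\mathcal{H})$ has no edge $ab$ with $a\in V(H_{t,\ell_t-1})$ and $b\in V(P_{t,\ell_t})\setminus\{a_{t,\ell_t},b_{t,\ell_t}\}$.
   Context: Graphs are finite and simple; $[i]=\{1,\dots,i\}$. For $S\subseteq V(G)$ and $r\ge0$, $B_G(S,r)$ is the set of vertices at distance at most $r$ from $S$ in $G$. $V_{\ge3}(G)$ is the set of vertices of degree at least $3$ in $G$. For a subgraph $H$ of $G$, an $H$-path is a path in $G$ of length at least $1$ whose ends lie in $V(H)$, whose internal vertices are not in $V(H)$, and which shares no edge with $H$. Coarse ear-decomposition: for positive integers $t,\ell_1,\dots,\ell_t$, a subgraph $\mathcal{H}=\bigcup_{i\in[t]}\bigcup_{j\in[\ell_i]}P_{i,j}$ of $G$ such that, with $H_{0,0}$ the null graph, $\ell_0=0$, $Y_{0,0}=Z_{0,0}=\emptyset$, and for $i\in[t],j\in[\ell_i]$: $H_{i,j}=\bigl(\bigcup_{p\in[i-1]}\bigcup_{q\in[\ell_p]}P_{p,q}\bigr)\cup\bigcup_{r\in[j]}P_{i,r}$, $Y_{i,j}=B_{H_{i,j}}(V_{\ge3}(H_{i,j}),2)$, $Z_{i,j}=B_{G-(V(H_{i,j})\setminus Y_{i,j})}(Y_{i,j},1)$, the following hold. (A) For each $i\in[t]$, $G-Z_{i-1,\ell_{i-1}}$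 has no $H_{i-1,\ell_{i-1}}$-path. (B) For each $i\in[t]$: if $G-Z_{i-1,\ell_{i-1}}$ has a cycle meeting $V(H_{i-1,\ell_{i-1}})$ in exactly one vertex, then $P_{i,1}$ is a shortest such cycle (type 1); otherwise $P_{i,1}$ is a shortest cycle of $G-Z_{i-1,\ell_{i-1}}$ (type 2). (C) For each $i\in[t]$ and $j\in[\ell_i]\setminus\{1\}$, $P_{i,j}$ is a shortest $H_{i,j-1}$-path of $G-Z_{i,j-1}$, with ends $a_{i,j},b_{i,j}$. -}

module Defs where

open import Data.Nat using (ℕ; zero; suc; _≤_; _∸_)
open import Data.Fin using (Fin)
open import Data.Bool using (Bool; true; false)
open import Data.List using (List; []; _∷_; _++_; take; length; [_]; _∷ʳ_)
open import Data.List.Membership.Propositional using (_∈_)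
open import Data.List.Relation.Unary.All using (All)
open import Data.List.Relation.Unary.Any using (Any)
open import Data.List.Relation.Unary.Linked using (Linked)
open import Data.List.Relation.Unary.Unique.Propositional using (Unique)
open import Data.Product using (Σ; ∃; ∃-syntax; _×_; _,_; proj₁; proj₂)
open import Relation.Nullary using (¬_)
open import Data.Sum using (_⊎_)
open import Data.Empty using (⊥)
open import Relation.Binary.PropositionalEquality using (_≡_; _≢_)

record Graph (n : ℕ) : Set₁ where
  field
    E     : Fin n → Fin n → Set
    sym   : ∀ {u v} → E u v → E v u
    irref : ∀ {u} → ¬ E u u
open Graph public

module _ {n : ℕ} where

  V : Set
  V = Fin n

  data Consec : List V → V → V → Set where
    here  : ∀ {u v xs} → Consec (u ∷ v ∷ xs) u v
    there : ∀ {x xs u v} → Consec xs u v → Consec (x ∷ xs) u v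

  EdgeOf : List V → V → V → Set
  EdgeOf xs u v = Consec xs u v ⊎ Consec xs v u

  -- cycle of G - Z given by a cyclic vertex list x₀ … x_{k-1}
  -- (edges x_i x_{i+1} and x_{k-1} x₀); its length is k
  IsCycleAvoid : Graph n → (V → Set) → List V → Set
  IsCycleAvoid G Z xs =
    (3 ≤ length xs) × Unique xs × Linked (E G) (xs ++ take 1 xs) × All (λ v → ¬ Z v) xs

  IsCycle : Graph n → List V → Set
  IsCycle G xs = IsCycleAvoid G (λ _ → ⊥) xs

  -- path of G - Z of length ≥ 1 given by its vertex list; length = #vertices - 1
  IsPathAvoid : Graph n → (V → Set) → List V → Set
  IsPathAvoid G Z xs =
    (2 ≤ length xs) × Unique xs × Linked (E G) xs × All (λ v → ¬ Z v) xs

  Girth≥5 : Graph n → Set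
  Girth≥5 G = ∀ xs → IsCycle G xs → 5 ≤ length xs

  -- an ear: flag true = first ear P_{i,1} of a block (a cycle),
  -- flag false = later ear P_{i,j}, j ≥ 2 (a path)
  Ear : Set
  Ear = Bool × List V

  closed : Ear → List V
  closed (true  , xs) = xs ++ take 1 xs
  closed (false , xs) = xs

  VH : List Ear → V → Set
  VH es v = Any (λ e → v ∈ proj₂ e) es

  EH : List Ear → V → V → Set
  EH es u v = Any (λ e → EdgeOf (closed e) u v) es

  -- distance-bounded reachability: Reach Adj S r v  iff  dist(S, v) ≤ r
  data Reach (Adj : V → V → Set) (S : V → Set) : ℕ → V → Set where
    here : ∀ {r v} → S v → Reach Adj S r v
    step : ∀ {r u v} → Reach Adj S r u → Adj u v → Reach Adj S (suc r) v

  Deg≥3 : List Ear → V → Set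
  Deg≥3 es v = ∃[ w₁ ] ∃[ w₂ ] ∃[ w₃ ]
    (EH es v w₁ × EH es v w₂ × EH es v w₃ × w₁ ≢ w₂ × w₁ ≢ w₃ × w₂ ≢ w₃)

  Ys : List Ear → V → Set
  Ys es = Reach (EH es) (Deg≥3 es) 2

  Zs : Graph n → List Ear → V → Set
  Zs G es = Reach Adj' (Ys es) 1
    where
    Removed : V → Set
    Removed x = VH es x × ¬ Ys es x
    Adj' : V → V → Set
    Adj' u w = E G u w × ¬ Removed u × ¬ Removed w

  HPath : Graph n → List Ear → List V → Set
  HPath G es xs =
    IsPathAvoid G (Zs G es) xs
    × (∃[ a ] ∃[ mid ] ∃[ b ] (xs ≡ a ∷ mid ∷ʳ b × VH es a × VH es b
                                  × All (λ v → ¬ VH es v) mid))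
    × (∀ u v → EdgeOf xs u v → ¬ EH es u v)

  OneMeetCycle : Graph n → List Ear → List V → Set
  OneMeetCycle G es xs =
    IsCycleAvoid G (Zs G es) xs
    × (∃[ v ] (v ∈ xs × VH es v × (∀ w → w ∈ xs → VH es w → w ≡ v)))

  Shortest : (List V → Set) → List V → Set
  Shortest P xs = P xs × (∀ ys → P ys → length xs ≤ length ys)

  EarOK : Graph n → List Ear → Ear → Set
  EarOK G pre (true , xs) =
      (∀ ys → ¬ HPath G pre ys)
    × ((∃[ ys ] OneMeetCycle G pre ys) → Shortest (OneMeetCycle G pre) xs)
    × (¬ (∃[ ys ] OneMeetCycle G pre ys)
         → Shortest (IsCycleAvoid G (Zs G pre)) xs)
  EarOK G pre (false , xs) = Shortest (HPath G pre) xs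

  -- a coarse ear-decomposition, as the flat sequence
  -- P_{1,1},…,P_{1,ℓ₁},P_{2,1},…,P_{t,ℓ_t}; flag true marks the P_{i,1}
  data FirstIsStart : List Ear → Set where
    start : ∀ {xs es} → FirstIsStart ((true , xs) ∷ es)

  CoarseEarDecomp : Graph n → List Ear → Set
  CoarseEarDecomp G es =
    FirstIsStart es × (∀ pre e post → es ≡ pre ++ e ∷ post → EarOK G pre e)

-- Write P = q ⋯ b ⋯ q′ for the last ear, a shortest H-path of G − Z, where H is the union of
-- the earlier ears. If a ≠ q′, the H-path a b ⋯ q′ is shorter than P unless b directly follows
-- q on P; symmetrically if a ≠ q. Hence ab is an end edge of P, unless P = q b q′ and b has the
-- three distinct neighbours a, q, q′ in V(H) ∖ Z.
--
-- That configuration is impossible. Take the first ear after which all three neighbours lie in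
-- H; b lies outside everything built so far. If two of them, y and z, are new on that ear,
-- reroute the ear through b: replacing its segment S from y to z by y b z gives the bypass, and
-- S together with b closes the loop. Their lengths add up to the length of the ear plus 4 and
-- every cycle has length at least 5, so the bypass is strictly shorter than the ear, and so is
-- the loop if the ear is a cycle; the vertex where a type-1 cycle meets H survives on one of
-- the two. If only one of them, z, is new, the other two x, y are already in H, so x b y is an
-- H-path of length 2 and the ear is a path q z q′; as q already has two neighbours in H, it
-- gets degree 3, which puts z into Y ⊆ Z.

module Submission where

open import Defs
open import Data.Nat using (ℕ; suc; _≤_; _<_; _+_; s≤s; z≤n)
open import Data.Nat.Properties
  using (≤-refl; ≤-trans; <⇒≱; m≤n⇒m≤1+n; +-comm; +-monoˡ-≤; +-monoʳ-<; +-cancelʳ-≤; module ≤-Reasoning)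
open import Data.Nat.Tactic.RingSolver using (solve-∀)
open import Data.Fin using (Fin; _≟_)
open import Data.Bool using (true; false)
open import Data.List using (List; []; _∷_; _++_; _∷ʳ_; [_]; take; length)
open import Data.List.Properties using (++-assoc; ++-identityʳ; length-++)
open import Data.List.Membership.Propositional using (_∈_; _∉_)
open import Data.List.Membership.Propositional.Properties using (∈-++⁻; ∈-++⁺ˡ; ∈-++⁺ʳ; ∈-∃++)
open import Data.List.Relation.Binary.Subset.Propositional using (_⊆_)
open import Data.List.Relation.Binary.Subset.Propositional.Properties using (xs⊆xs++ys; Any-resp-⊆)
open import Data.List.Relation.Unary.All as All using (All; []; _∷_)
open import Data.List.Relation.Unary.All.Properties using (¬Any⇒All¬)
  renaming (++⁺ to All-++⁺; ++⁻ˡ to All-++⁻ˡ; ++⁻ʳ to All-++⁻ʳ)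
open import Data.List.Relation.Unary.AllPairs using ([]; _∷_)
open import Data.List.Relation.Unary.Any as Any using (here; there)
open import Data.List.Relation.Unary.Any.Properties using ()
  renaming (++⁺ˡ to Any-++⁺ˡ; ++⁺ʳ to Any-++⁺ʳ; ++⁻ to Any-++⁻)
open import Data.List.Relation.Unary.Linked as Linked using (Linked; []; [-]; _∷_)
open import Data.List.Relation.Unary.Unique.Propositional using (Unique)
open import Data.Product as Product using (∃-syntax; _×_; _,_; proj₁; proj₂)
open import Data.Sum as Sum using (_⊎_; inj₁; inj₂)
open import Data.Empty using (⊥; ⊥-elim)
open import Function using (_∘_)
open import Relation.Nullary using (¬_; Dec; yes; no)
open import Relation.Nullary.Negation using (¬¬-map)
open import Relation.Binary.PropositionalEquality using (_≡_; _≢_; refl)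
import Relation.Binary.PropositionalEquality as ≡

module _ {A : Set} where

  ∈∧∉⇒≢ : ∀ {x y : A} {xs} → x ∈ xs → y ∉ xs → x ≢ y
  ∈∧∉⇒≢ x∈ y∉ refl = y∉ x∈

  Unique-∷ : ∀ {x : A} {xs} → x ∉ xs → Unique xs → Unique (x ∷ xs)
  Unique-∷ {xs = xs} x∉ u = ¬Any⇒All¬ xs x∉ ∷ u

  Unique-++⁻ˡ : ∀ (xs : List A) {ys} → Unique (xs ++ ys) → Unique xs
  Unique-++⁻ˡ []       _          = []
  Unique-++⁻ˡ (x ∷ xs) (x∉ ∷ u) = All-++⁻ˡ xs x∉ ∷ Unique-++⁻ˡ xs u

  Unique-++⁻ʳ : ∀ (xs : List A) {ys} → Unique (xs ++ ys) → Unique ys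
  Unique-++⁻ʳ []       u       = u
  Unique-++⁻ʳ (x ∷ xs) (_ ∷ u) = Unique-++⁻ʳ xs u

  Unique-++⇒disjoint : ∀ (xs : List A) {ys x y} → Unique (xs ++ ys) → x ∈ xs → y ∈ ys → x ≢ y
  Unique-++⇒disjoint (x ∷ xs) (x∉ ∷ _) (here refl) y∈ = All.lookup x∉ (∈-++⁺ʳ xs y∈)
  Unique-++⇒disjoint (x ∷ xs) (_ ∷ u)  (there x∈)  y∈ = Unique-++⇒disjoint xs u x∈ y∈

  Unique-∷ʳ : ∀ {x : A} {xs} → x ∉ xs → Unique xs → Unique (xs ∷ʳ x)
  Unique-∷ʳ {xs = []}     _  []       = [] ∷ []
  Unique-∷ʳ {xs = y ∷ xs} x∉ (y∉ ∷ u) =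
    All-++⁺ y∉ (∈∧∉⇒≢ (here refl) x∉ ∷ []) ∷ Unique-∷ʳ (x∉ ∘ there) u

  ∈-path⁻ : ∀ (q : A) mid {q′ v} → v ∈ q ∷ mid ∷ʳ q′ → v ≡ q ⊎ v ∈ mid ⊎ v ≡ q′
  ∈-path⁻ q mid (here refl) = inj₁ refl
  ∈-path⁻ q mid (there v∈) with ∈-++⁻ mid v∈
  ... | inj₁ v∈mid        = inj₂ (inj₁ v∈mid)
  ... | inj₂ (here refl)  = inj₂ (inj₂ refl)

  ends-distinct : ∀ {q : A} {mid q′} → Unique (q ∷ mid ∷ʳ q′) → q ≢ q′
  ends-distinct {mid = mid} (q∉ ∷ _) = All.lookup q∉ (∈-++⁺ʳ mid (here refl))

  ∉-path : ∀ {q : A} {mid q′ v} → v ≢ q → v ∉ mid → v ≢ q′ → v ∉ q ∷ mid ∷ʳ q′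
  ∉-path {q} {mid} v≢q v∉mid v≢q′ v∈ = Sum.[ v≢q , Sum.[ v∉mid , v≢q′ ] ] (∈-path⁻ q mid v∈)

  ∈-interior : ∀ {P : A → Set} (q : A) mid {q′ v} →
               P q → P q′ → ¬ P v → v ∈ q ∷ mid ∷ʳ q′ → v ∈ mid
  ∈-interior q mid pq pq′ ¬pv v∈ with ∈-path⁻ q mid v∈
  ... | inj₁ refl         = ⊥-elim (¬pv pq)
  ... | inj₂ (inj₁ v∈mid) = v∈mid
  ... | inj₂ (inj₂ refl)  = ⊥-elim (¬pv pq′)

  split-∈-∈ : ∀ {y z : A} xs → y ∈ xs → z ∈ xs → y ≢ z →
              (∃[ L₁ ] ∃[ L₂ ] ∃[ L₃ ] xs ≡ L₁ ++ y ∷ L₂ ++ z ∷ L₃) ⊎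
              (∃[ L₁ ] ∃[ L₂ ] ∃[ L₃ ] xs ≡ L₁ ++ z ∷ L₂ ++ y ∷ L₃)
  split-∈-∈ (x ∷ xs) (here refl) (here refl) y≢z = ⊥-elim (y≢z refl)
  split-∈-∈ (x ∷ xs) (here refl) (there z∈) _
    with L₂ , L₃ , refl ← ∈-∃++ z∈ = inj₁ ([] , L₂ , L₃ , refl)
  split-∈-∈ (x ∷ xs) (there y∈) (here refl) _
    with L₂ , L₃ , refl ← ∈-∃++ y∈ = inj₂ ([] , L₂ , L₃ , refl)
  split-∈-∈ (x ∷ xs) (there y∈) (there z∈) y≢z =
    Sum.map (λ (L₁ , L₂ , L₃ , eq) → x ∷ L₁ , L₂ , L₃ , ≡.cong (x ∷_) eq)
            (λ (L₁ , L₂ , L₃ , eq) → x ∷ L₁ , L₂ , L₃ , ≡.cong (x ∷_) eq)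
            (split-∈-∈ xs y∈ z∈ y≢z)

  length-++-≥ʳ : ∀ (xs : List A) {ys} → length ys ≤ length (xs ++ ys)
  length-++-≥ʳ []       = ≤-refl
  length-++-≥ʳ (x ∷ xs) = m≤n⇒m≤1+n (length-++-≥ʳ xs)

prefix-induction : ∀ {A : Set} (P : List A → Set) xs → P [] →
                   (∀ p e rest → xs ≡ p ++ e ∷ rest → P p → P (p ∷ʳ e)) → P xs
prefix-induction P xs P[] P-∷ʳ = go [] xs refl P[]
  where
  go : ∀ p rest → xs ≡ p ++ rest → P p → P xs
  go p []         eq Pp = ≡.subst P (≡.sym (≡.trans eq (++-identityʳ p))) Pp
  go p (e ∷ rest) eq Pp =
    go (p ∷ʳ e) rest (≡.trans eq (≡.sym (++-assoc p [ e ] rest))) (P-∷ʳ p e rest eq Pp)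

module _ {A : Set} {R : A → A → Set} where

  Linked-++⁻ˡ : ∀ xs {ys} → Linked R (xs ++ ys) → Linked R xs
  Linked-++⁻ˡ []           _       = []
  Linked-++⁻ˡ (x ∷ [])     _       = [-]
  Linked-++⁻ˡ (x ∷ y ∷ xs) (r ∷ l) = r ∷ Linked-++⁻ˡ (y ∷ xs) l

  Linked-++⁻ʳ : ∀ xs {ys} → Linked R (xs ++ ys) → Linked R ys
  Linked-++⁻ʳ []       l = l
  Linked-++⁻ʳ (x ∷ xs) l = Linked-++⁻ʳ xs (Linked.tail l)

  Linked-∷ʳ : ∀ xs {y z} → Linked R (xs ∷ʳ y) → R y z → Linked R (xs ∷ʳ y ∷ʳ z)
  Linked-∷ʳ []           _       r = r ∷ [-]
  Linked-∷ʳ (x ∷ [])     (r′ ∷ _) r = r′ ∷ r ∷ [-]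
  Linked-∷ʳ (x ∷ y ∷ xs) (r′ ∷ l) r = r′ ∷ Linked-∷ʳ (y ∷ xs) l r

  Linked-++-∷⇒∷ʳ : ∀ xs {z ys} → Linked R (xs ++ z ∷ ys) → Linked R (xs ∷ʳ z)
  Linked-++-∷⇒∷ʳ []           _       = [-]
  Linked-++-∷⇒∷ʳ (x ∷ [])     (r ∷ _) = r ∷ [-]
  Linked-++-∷⇒∷ʳ (x ∷ y ∷ xs) (r ∷ l) = r ∷ Linked-++-∷⇒∷ʳ (y ∷ xs) l

-- Rerouting W = L₁ y L₂ z L₃ through a vertex b: the bypass L₁ y b z L₃ and the loop z b y L₂

module _ {A : Set} {y z : A} {L₂ L₃ : List A} where

  bypass-++ : ∀ L₁ {t} → (L₁ ++ y ∷ L₂ ++ z ∷ L₃) ++ t ≡ L₁ ++ y ∷ L₂ ++ z ∷ (L₃ ++ t)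
  bypass-++ L₁ {t} = ≡.trans (++-assoc L₁ _ t) (≡.cong (λ r → L₁ ++ y ∷ r) (++-assoc L₂ (z ∷ L₃) t))

  closed-bypass : ∀ L₁ → let W = L₁ ++ y ∷ L₂ ++ z ∷ L₃ in
                  W ++ take 1 W ≡ L₁ ++ y ∷ L₂ ++ z ∷ (L₃ ++ take 1 (L₁ ++ [ y ]))
  closed-bypass []       = bypass-++ []
  closed-bypass (x ∷ L₁) = ≡.cong (x ∷_) (bypass-++ L₁)

module _ {A : Set} {y z b : A} {L₂ L₃ : List A} where

  All-bypass : ∀ {P : A → Set} L₁ → All P (L₁ ++ y ∷ L₂ ++ z ∷ L₃) → P b →
               All P (L₁ ++ y ∷ b ∷ z ∷ L₃)
  All-bypass []       (py ∷ pw) pb = py ∷ pb ∷ All-++⁻ʳ L₂ pw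
  All-bypass (x ∷ L₁) (px ∷ pw) pb = px ∷ All-bypass L₁ pw pb

  All-loop : ∀ {P : A → Set} L₁ → All P (L₁ ++ y ∷ L₂ ++ z ∷ L₃) → P b → All P (z ∷ b ∷ y ∷ L₂)
  All-loop L₁ pw pb with py ∷ pw′ ← All-++⁻ʳ L₁ pw with pz ∷ _ ← All-++⁻ʳ L₂ pw′ =
    pz ∷ pb ∷ py ∷ All-++⁻ˡ L₂ pw′

  Unique-bypass : ∀ L₁ → Unique (L₁ ++ y ∷ L₂ ++ z ∷ L₃) → b ∉ L₁ ++ y ∷ L₂ ++ z ∷ L₃ →
                  Unique (L₁ ++ y ∷ b ∷ z ∷ L₃)
  Unique-bypass []       (y∉ ∷ u) b∉ =
    (∈∧∉⇒≢ (here refl) b∉ ∷ All-++⁻ʳ L₂ y∉) ∷ Unique-∷ (b∉ ∘ there ∘ ∈-++⁺ʳ L₂) (Unique-++⁻ʳ L₂ u)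
  Unique-bypass (x ∷ L₁) (x∉ ∷ u) b∉ =
    All-bypass L₁ x∉ (∈∧∉⇒≢ (here refl) b∉) ∷ Unique-bypass L₁ u (b∉ ∘ there)

  Unique-loop : ∀ L₁ → Unique (L₁ ++ y ∷ L₂ ++ z ∷ L₃) → b ∉ L₁ ++ y ∷ L₂ ++ z ∷ L₃ →
                Unique (z ∷ b ∷ y ∷ L₂)
  Unique-loop L₁ u b∉ = Unique-∷ z∉ (Unique-∷ (b∉ ∘ ∈-++⁺ʳ L₁ ∘ ∈-++⁺ˡ) (Unique-++⁻ˡ (y ∷ L₂) u′))
    where
    u′ = Unique-++⁻ʳ L₁ u
    z∉ : z ∉ b ∷ y ∷ L₂
    z∉ (here z≡b)   = ∈∧∉⇒≢ (∈-++⁺ʳ L₁ (there (∈-++⁺ʳ L₂ (here refl)))) b∉ z≡b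
    z∉ (there z∈) = Unique-++⇒disjoint (y ∷ L₂) u′ z∈ (here refl) refl

  module _ {R : A → A → Set} where

    Linked-bypass : ∀ L₁ → Linked R (L₁ ++ y ∷ L₂ ++ z ∷ L₃) → R y b → R b z →
                    Linked R (L₁ ++ y ∷ b ∷ z ∷ L₃)
    Linked-bypass []            l       ryb rbz = ryb ∷ rbz ∷ Linked-++⁻ʳ (y ∷ L₂) l
    Linked-bypass (x ∷ [])      (r ∷ l) ryb rbz = r ∷ Linked-bypass [] l ryb rbz
    Linked-bypass (x ∷ x′ ∷ L₁) (r ∷ l) ryb rbz = r ∷ Linked-bypass (x′ ∷ L₁) l ryb rbz

    Linked-loop : ∀ L₁ → Linked R (L₁ ++ y ∷ L₂ ++ z ∷ L₃) → R z b → R b y →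
                  Linked R (z ∷ b ∷ y ∷ L₂ ++ [ z ])
    Linked-loop L₁ l rzb rby = rzb ∷ rby ∷ Linked-++-∷⇒∷ʳ (y ∷ L₂) (Linked-++⁻ʳ L₁ l)

  ∈-bypass-or-loop : ∀ L₁ {v} → v ∈ L₁ ++ y ∷ L₂ ++ z ∷ L₃ →
                     v ∈ L₁ ++ y ∷ b ∷ z ∷ L₃ ⊎ v ∈ z ∷ b ∷ y ∷ L₂
  ∈-bypass-or-loop (x ∷ L₁) (here refl) = inj₁ (here refl)
  ∈-bypass-or-loop (x ∷ L₁) (there v∈)  = Sum.map₁ there (∈-bypass-or-loop L₁ v∈)
  ∈-bypass-or-loop []       (here refl) = inj₁ (here refl)
  ∈-bypass-or-loop []       (there v∈) with ∈-++⁻ L₂ v∈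
  ... | inj₁ v∈L₂          = inj₂ (there (there (there v∈L₂)))
  ... | inj₂ (here refl)   = inj₁ (there (there (here refl)))
  ... | inj₂ (there v∈L₃)  = inj₁ (there (there (there v∈L₃)))

  length-loop+bypass : ∀ L₁ → length (z ∷ b ∷ y ∷ L₂) + length (L₁ ++ y ∷ b ∷ z ∷ L₃) ≡
                              length (L₁ ++ y ∷ L₂ ++ z ∷ L₃) + 4
  length-loop+bypass L₁
    rewrite length-++ L₁ {y ∷ b ∷ z ∷ L₃} | length-++ L₁ {y ∷ L₂ ++ z ∷ L₃} | length-++ L₂ {z ∷ L₃} =
    arith (length L₁) (length L₂) (length L₃)
    where
    arith : ∀ l₁ l₂ l₃ → 3 + l₂ + (l₁ + (3 + l₃)) ≡ l₁ + suc (l₂ + suc l₃) + 4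
    arith = solve-∀

+≡+4⇒< : ∀ d {s w} → d + s ≡ w + 4 → 5 ≤ d → s < w
+≡+4⇒< d {s} {w} eq 5≤d = +-cancelʳ-≤ 4 (suc s) w (begin
  suc s + 4 ≡⟨ +-comm (suc s) 4 ⟩
  5 + s     ≤⟨ +-monoˡ-≤ s 5≤d ⟩
  d + s     ≡⟨ eq ⟩
  w + 4     ∎)
  where open ≤-Reasoning

module _ {n : ℕ} (G : Graph n) where

  -- IsPathAvoid G Z xs unfolds to 2 ≤ length xs × Walk G Z xs.
  Walk : (Fin n → Set) → List (Fin n) → Set
  Walk Z xs = Unique xs × Linked (E G) xs × All (λ v → ¬ Z v) xs

module _ {n : ℕ} (G : Graph n) {Z : Fin n → Set} where

  girth-≥5 : Girth≥5 G → ∀ {xs} → IsCycleAvoid G Z xs → 5 ≤ length xs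
  girth-≥5 gir (len , u , l , _) = gir _ (len , u , l , All.tabulate (λ _ ()))

  IsCycleAvoid⇒Walk : ∀ {xs} → IsCycleAvoid G Z xs → Walk G Z xs
  IsCycleAvoid⇒Walk {xs} (_ , u , l , nz) = u , Linked-++⁻ˡ xs l , nz

  module _ {y z b : Fin n} {L₂ L₃ : List (Fin n)} where

    loop-cycle : ∀ L₁ → Walk G Z (L₁ ++ y ∷ L₂ ++ z ∷ L₃) → b ∉ L₁ ++ y ∷ L₂ ++ z ∷ L₃ → ¬ Z b →
                 E G z b → E G b y → IsCycleAvoid G Z (z ∷ b ∷ y ∷ L₂)
    loop-cycle L₁ (u , l , nz) b∉ b∉Z ezb eby =
      s≤s (s≤s (s≤s z≤n)) , Unique-loop L₁ u b∉ , Linked-loop L₁ l ezb eby , All-loop L₁ nz b∉Z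

    bypass-walk : ∀ L₁ → Walk G Z (L₁ ++ y ∷ L₂ ++ z ∷ L₃) → b ∉ L₁ ++ y ∷ L₂ ++ z ∷ L₃ → ¬ Z b →
                  E G y b → E G b z → Walk G Z (L₁ ++ y ∷ b ∷ z ∷ L₃)
    bypass-walk L₁ (u , l , nz) b∉ b∉Z eyb ebz =
      Unique-bypass L₁ u b∉ , Linked-bypass L₁ l eyb ebz , All-bypass L₁ nz b∉Z

    bypass-cycle : ∀ L₁ → IsCycleAvoid G Z (L₁ ++ y ∷ L₂ ++ z ∷ L₃) → b ∉ L₁ ++ y ∷ L₂ ++ z ∷ L₃ →
                   ¬ Z b → E G y b → E G b z → IsCycleAvoid G Z (L₁ ++ y ∷ b ∷ z ∷ L₃)
    bypass-cycle L₁ (_ , u , l , nz) b∉ b∉Z eyb ebz =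
      ≤-trans (s≤s (s≤s (s≤s z≤n))) (length-++-≥ʳ L₁) ,
      Unique-bypass L₁ u b∉ ,
      ≡.subst (Linked (E G)) (≡.sym (closed-bypass {L₂ = [ b ]} L₁))
        (Linked-bypass L₁ (≡.subst (Linked (E G)) (closed-bypass L₁) l) eyb ebz) ,
      All-bypass L₁ nz b∉Z

    bypass-shorter : Girth≥5 G → ∀ L₁ → IsCycleAvoid G Z (z ∷ b ∷ y ∷ L₂) →
                     length (L₁ ++ y ∷ b ∷ z ∷ L₃) < length (L₁ ++ y ∷ L₂ ++ z ∷ L₃)
    bypass-shorter gir L₁ loop =
      +≡+4⇒< (3 + length L₂) (length-loop+bypass {b = b} L₁) (girth-≥5 gir loop)

    loop-shorter : Girth≥5 G → ∀ L₁ → IsCycleAvoid G Z (L₁ ++ y ∷ b ∷ z ∷ L₃) →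
                   length (z ∷ b ∷ y ∷ L₂) < length (L₁ ++ y ∷ L₂ ++ z ∷ L₃)
    loop-shorter gir L₁ bypass =
      +≡+4⇒< (length (L₁ ++ y ∷ b ∷ z ∷ L₃))
        (≡.trans (+-comm (length (L₁ ++ y ∷ b ∷ z ∷ L₃)) _) (length-loop+bypass L₁))
        (girth-≥5 gir bypass)

-- Ear unions and the sets Y and Z

module _ {n : ℕ} where

  Consec⇒∈ : ∀ {xs : List (Fin n)} {u v} → Consec xs u v → u ∈ xs × v ∈ xs
  Consec⇒∈ here      = here refl , there (here refl)
  Consec⇒∈ (there c) = Product.map there there (Consec⇒∈ c)

  Consec-∷ʳ⇒∈ : ∀ {xs : List (Fin n)} {x u v} → Consec (xs ∷ʳ x) u v → u ∈ xs
  Consec-∷ʳ⇒∈ {[]}              (there ())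
  Consec-∷ʳ⇒∈ {_ ∷ []}          here              = here refl
  Consec-∷ʳ⇒∈ {_ ∷ []}          (there (there ()))
  Consec-∷ʳ⇒∈ {_ ∷ _ ∷ _}       here              = here refl
  Consec-∷ʳ⇒∈ {_ ∷ xs@(_ ∷ _)} (there c)         = there (Consec-∷ʳ⇒∈ {xs} c)

  Consec-∷ʳ-∷ʳ : ∀ (xs : List (Fin n)) {u v} → Consec (xs ∷ʳ u ∷ʳ v) u v
  Consec-∷ʳ-∷ʳ []       = here
  Consec-∷ʳ-∷ʳ (x ∷ xs) = there (Consec-∷ʳ-∷ʳ xs)

  EdgeOf-interior : ∀ {q : Fin n} {mid q′ w u v} → w ∈ mid → EdgeOf (q ∷ mid ∷ʳ q′) u v →
                    u ∈ mid ⊎ v ∈ mid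
  EdgeOf-interior {mid = _ ∷ _} _ (inj₁ here)      = inj₂ (here refl)
  EdgeOf-interior {mid = _ ∷ _} _ (inj₁ (there c)) = inj₁ (Consec-∷ʳ⇒∈ c)
  EdgeOf-interior {mid = _ ∷ _} _ (inj₂ here)      = inj₁ (here refl)
  EdgeOf-interior {mid = _ ∷ _} _ (inj₂ (there c)) = inj₂ (Consec-∷ʳ⇒∈ c)

  ∈-closed⁻ : ∀ (e : Ear {n}) {v} → v ∈ closed e → v ∈ proj₂ e
  ∈-closed⁻ (true , xs) v∈ with ∈-++⁻ xs v∈
  ∈-closed⁻ (true , xs)     _ | inj₁ v∈xs       = v∈xs
  ∈-closed⁻ (true , x ∷ xs) _ | inj₂ (here refl) = here refl
  ∈-closed⁻ (false , xs) v∈ = v∈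

  EH⇒VH : ∀ {es : List (Ear {n})} {u v} → EH es u v → VH es u × VH es v
  EH⇒VH uv∈H = Any.map (λ {e} → ∈-closed⁻ e ∘ proj₁ ∘ endpoints) uv∈H ,
               Any.map (λ {e} → ∈-closed⁻ e ∘ proj₂ ∘ endpoints) uv∈H
    where
    endpoints : ∀ {xs : List (Fin n)} {u v} → EdgeOf xs u v → u ∈ xs × v ∈ xs
    endpoints (inj₁ c) = Consec⇒∈ c
    endpoints (inj₂ c) = Product.swap (Consec⇒∈ c)

  Reach-map : ∀ {Adj Adj′ : Fin n → Fin n → Set} {S S′ : Fin n → Set} {r v} →
              (∀ {u w} → Adj u w → Adj′ u w) → (∀ {u} → S u → S′ u) →
              Reach Adj S r v → Reach Adj′ S′ r v
  Reach-map f g (here s)   = here (g s)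
  Reach-map f g (step r a) = step (Reach-map f g r) (f a)

  Ys-mono : ∀ {es fs : List (Ear {n})} {v} → es ⊆ fs → Ys es v → Ys fs v
  Ys-mono sub = Reach-map (Any-resp-⊆ sub) λ (w₁ , w₂ , w₃ , e₁ , e₂ , e₃ , ≢s) →
    w₁ , w₂ , w₃ , Any-resp-⊆ sub e₁ , Any-resp-⊆ sub e₂ , Any-resp-⊆ sub e₃ , ≢s

  VH? : ∀ (es : List (Ear {n})) v → Dec (VH es v)
  VH? es v = Any.any? (λ e → v ∈? proj₂ e) es
    where open import Data.List.Membership.DecPropositional (_≟_ {n}) using (_∈?_)

module _ {n : ℕ} (G : Graph n) {es : List (Ear {n})} where

  Zs-step : ∀ {u v} → Ys es u → E G u v → ¬ VH es v → Zs G es v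
  Zs-step yu euv v∉H = step (here yu) (euv , (λ (_ , ¬yu) → ¬yu yu) , (λ (v∈H , _) → v∉H v∈H))

  Zs∩VH⇒Ys : ∀ {v} → VH es v → Zs G es v → ¬ ¬ Ys es v
  Zs∩VH⇒Ys _   (here yv)                  ¬yv = ¬yv yv
  Zs∩VH⇒Ys v∈H (step _ (_ , _ , v-kept)) ¬yv = v-kept (v∈H , ¬yv)

  ¬Zs-neighbour : ∀ {a b} → VH es a → E G a b → ¬ VH es b → ¬ Zs G es b → ¬ Zs G es a
  ¬Zs-neighbour a∈H eab b∉H b∉Z a∈Z = Zs∩VH⇒Ys a∈H a∈Z (λ ya → b∉Z (Zs-step ya eab b∉H))

  HPath-intro : ∀ {xs q mid q′ w} → IsPathAvoid G (Zs G es) xs → xs ≡ q ∷ mid ∷ʳ q′ →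
                VH es q → VH es q′ → All (λ v → ¬ VH es v) mid → w ∈ mid → HPath G es xs
  HPath-intro pa refl q∈H q′∈H mid∉H w∈ = pa , (_ , _ , _ , refl , q∈H , q′∈H , mid∉H) , no-H-edge
    where
    no-H-edge : ∀ u v → EdgeOf _ u v → ¬ EH es u v
    no-H-edge u v uv uv∈H = Sum.[ (λ u∈ → All.lookup mid∉H u∈ (proj₁ (EH⇒VH uv∈H))) ,
                                  (λ v∈ → All.lookup mid∉H v∈ (proj₂ (EH⇒VH uv∈H))) ]
                                (EdgeOf-interior w∈ uv)

module _ {n : ℕ} (G : Graph n) {es fs : List (Ear {n})} (es⊆fs : es ⊆ fs) where

  ¬Zs-⊆ : ∀ {v} → VH es v → ¬ Zs G fs v → ¬ Zs G es v
  ¬Zs-⊆ v∈H v∉Z v∈Z = Zs∩VH⇒Ys G v∈H v∈Z (v∉Z ∘ here ∘ Ys-mono es⊆fs)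

  ¬Zs-⊆-outside : ∀ {v} → ¬ VH fs v → ¬ Zs G fs v → ¬ Zs G es v
  ¬Zs-⊆-outside _   v∉Z (here yv)                = v∉Z (here (Ys-mono es⊆fs yv))
  ¬Zs-⊆-outside v∉H v∉Z (step (here yu) (euv , _)) = v∉Z (Zs-step G (Ys-mono es⊆fs yu) euv v∉H)

-- Minimum degree two

module _ {n : ℕ} where

  record TwoNeighbours (R : Fin n → Fin n → Set) (v : Fin n) : Set where
    constructor two-neighbours
    field
      {w₁ w₂} : Fin n
      edge₁   : R v w₁
      edge₂   : R v w₂
      w₁≢w₂   : w₁ ≢ w₂

  TwoNeighbours-map : ∀ {R R′ : Fin n → Fin n → Set} {v} →
                      (∀ {u w} → R u w → R′ u w) → TwoNeighbours R v → TwoNeighbours R′ v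
  TwoNeighbours-map f (two-neighbours r₁ r₂ w₁≢w₂) = two-neighbours (f r₁) (f r₂) w₁≢w₂

  Consec-++⁺ʳ : ∀ xs {ys : List (Fin n)} {u v} → Consec ys u v → Consec (xs ++ ys) u v
  Consec-++⁺ʳ []       c = c
  Consec-++⁺ʳ (x ∷ xs) c = there (Consec-++⁺ʳ xs c)

  predecessor : ∀ (u : Fin n) L {v R} → ∃[ w ] (w ∈ u ∷ L × Consec (u ∷ L ++ v ∷ R) w v)
  predecessor u []      = u , here refl , here
  predecessor u (l ∷ L) with w , w∈ , c ← predecessor l L = w , there w∈ , there c

  successor : ∀ L (v : Fin n) M {t} → ∃[ w ] (w ∈ M ∷ʳ t × Consec (L ++ v ∷ M ∷ʳ t) v w)
  successor L v []      = _ , here refl , Consec-++⁺ʳ L here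
  successor L v (m ∷ M) = m , here refl , Consec-++⁺ʳ L here

  path-neighbours : ∀ (q : Fin n) mid {q′ v} → Unique (q ∷ mid ∷ʳ q′) → v ∈ mid →
                    TwoNeighbours (EdgeOf (q ∷ mid ∷ʳ q′)) v
  path-neighbours q mid {q′} uq v∈ with M₁ , M₂ , refl ← ∈-∃++ v∈
    with p , p∈ , cp ← predecessor q M₁ | s , s∈ , cs ← successor (q ∷ M₁) _ M₂ {q′} =
    two-neighbours (inj₂ (from cp)) (inj₁ (from cs))
      (Unique-++⇒disjoint (q ∷ M₁) (≡.subst Unique eq uq) p∈ (there s∈))
    where
    eq = ≡.cong (q ∷_) (++-assoc M₁ (_ ∷ M₂) [ q′ ])
    from : ∀ {u w} → Consec (q ∷ M₁ ++ _ ∷ M₂ ∷ʳ q′) u w → Consec (q ∷ (M₁ ++ _ ∷ M₂) ∷ʳ q′) u w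
    from {u} {w} = ≡.subst (λ xs → Consec xs u w) (≡.sym eq)

  cycle-neighbours : ∀ {C : List (Fin n)} {v} → Unique C → 3 ≤ length C → v ∈ C →
                     TwoNeighbours (EdgeOf (C ++ take 1 C)) v
  cycle-neighbours uq len v∈ with L , R , refl ← ∈-∃++ v∈ = around L R uq len
    where
    around : ∀ L R {v} → Unique (L ++ v ∷ R) → 3 ≤ length (L ++ v ∷ R) →
             TwoNeighbours (EdgeOf ((L ++ v ∷ R) ++ take 1 (L ++ v ∷ R))) v
    around [] (r₁ ∷ r₂ ∷ R) (_ ∷ r₁∉ ∷ _) _ with p , p∈ , c ← predecessor r₂ R {R = []} =
      two-neighbours (inj₁ here) (inj₂ (there (there c))) (All.lookup r₁∉ p∈)
    around (u ∷ L) R {v} uq len =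
      ≡.subst (λ xs → TwoNeighbours (EdgeOf xs) v) (≡.sym (≡.cong (u ∷_) (++-assoc L (v ∷ R) [ u ])))
        (closing-at u L R uq len)
      where
      closing-at : ∀ u L R → Unique (u ∷ L ++ v ∷ R) → 3 ≤ length (u ∷ L ++ v ∷ R) →
                   TwoNeighbours (EdgeOf (u ∷ L ++ v ∷ R ∷ʳ u)) v
      closing-at u L (r ∷ R) uq _ with p , p∈ , c ← predecessor u L =
        two-neighbours (inj₂ c) (inj₁ (Consec-++⁺ʳ (u ∷ L) here))
          (Unique-++⇒disjoint (u ∷ L) uq p∈ (there (here refl)))
      closing-at u (l ∷ L) [] (u∉ ∷ _) _ with p , p∈ , c ← predecessor l L =
        two-neighbours (inj₁ (Consec-++⁺ʳ (u ∷ l ∷ L) here)) (inj₂ (there c))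
          (All.lookup u∉ (∈-++⁺ˡ p∈))
      closing-at u [] [] _ (s≤s (s≤s ()))
    around [] []           _ (s≤s ())
    around [] (_ ∷ [])     _ (s≤s (s≤s ()))

  MinDegree≥2 : List (Ear {n}) → Set
  MinDegree≥2 es = ∀ v → VH es v → ¬ ¬ TwoNeighbours (EH es) v

module _ {n : ℕ} (G : Graph n) where

  EarsOK : List (Ear {n}) → Set
  EarsOK es = ∀ pre e post → es ≡ pre ++ e ∷ post → EarOK G pre e

  EarsOK-++⁻ˡ : ∀ es {fs} → EarsOK (es ++ fs) → EarsOK es
  EarsOK-++⁻ˡ es {fs} ok pre e post refl = ok pre e (post ++ fs) (++-assoc pre (e ∷ post) fs)

  -- Which of the two kinds a first ear is cannot be decided here, hence the double negation
  -- here and in MinDegree≥2.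
  EarOK⇒cycle : ∀ {p C} → EarOK G p (true , C) → ¬ ¬ IsCycleAvoid G (Zs G p) C
  EarOK⇒cycle (_ , type1 , type2) ¬cycle = ¬cycle (proj₁ (type2 (¬cycle ∘ proj₁ ∘ proj₁ ∘ type1)))

  private
    old-vertex : ∀ {p : List (Ear {n})} {e v} → MinDegree≥2 p → VH p v →
                 ¬ ¬ TwoNeighbours (EH (p ∷ʳ e)) v
    old-vertex {p} deg v∈p = ¬¬-map (TwoNeighbours-map Any-++⁺ˡ) (deg _ v∈p)

    new-vertex : ∀ {p} e {v} → MinDegree≥2 p → EarOK G p e → v ∈ proj₂ e →
                 ¬ ¬ TwoNeighbours (EH (p ∷ʳ e)) v
    new-vertex {p} (true , C) _ ok v∈C =
      ¬¬-map (λ (len , uq , _) → TwoNeighbours-map (Any-++⁺ʳ p ∘ here)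
                                   (cycle-neighbours uq len v∈C))
             (EarOK⇒cycle ok)
    new-vertex {p} (false , _) deg (((_ , uq , _) , (q , mid , q′ , refl , q∈H , q′∈H , _) , _) , _) v∈Q
      with ∈-path⁻ q mid v∈Q
    ... | inj₁ refl         = old-vertex deg q∈H
    ... | inj₂ (inj₁ v∈mid) = λ ¬two → ¬two (TwoNeighbours-map (Any-++⁺ʳ p ∘ here)
                                                (path-neighbours q mid uq v∈mid))
    ... | inj₂ (inj₂ refl)  = old-vertex deg q′∈H

  MinDegree≥2-∷ʳ : ∀ {p e} → MinDegree≥2 p → EarOK G p e → MinDegree≥2 (p ∷ʳ e)
  MinDegree≥2-∷ʳ {p} {e} deg ok v v∈ with Any-++⁻ p v∈
  ... | inj₁ v∈p        = old-vertex deg v∈p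
  ... | inj₂ (here v∈e) = new-vertex e deg ok v∈e

  EarsOK⇒MinDegree≥2 : ∀ {es} → EarsOK es → MinDegree≥2 es
  EarsOK⇒MinDegree≥2 {es} ok =
    prefix-induction MinDegree≥2 es (λ _ ()) (λ p e rest eq deg → MinDegree≥2-∷ʳ deg (ok p e rest eq))

-- Shortest ears cannot be rerouted through an outside vertex

module _ {n : ℕ} (G : Graph n) (gir : Girth≥5 G) {p : List (Ear {n})} {b : Fin n}
         (b∉H : ¬ VH p b) (b∉Z : ¬ Zs G p b) where

  shorter-HPath-via-bypass : ∀ q M₁ {M₂ M₃ q′ y z} → let Q = q ∷ (M₁ ++ y ∷ M₂ ++ z ∷ M₃) ∷ʳ q′ in
                             IsPathAvoid G (Zs G p) Q → VH p q → VH p q′ →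
                             All (λ v → ¬ VH p v) (M₁ ++ y ∷ M₂ ++ z ∷ M₃) → b ∉ Q → E G y b → E G b z →
                             ∃[ Q′ ] (HPath G p Q′ × length Q′ < length Q)
  shorter-HPath-via-bypass q M₁ {M₂} {M₃} {q′} {y} {z} (_ , walk) q∈H q′∈H mid∉H b∉Q eyb ebz =
    _ ,
    HPath-intro G (≤-trans (s≤s (s≤s z≤n)) (length-++-≥ʳ (q ∷ M₁)) ,
                   bypass-walk G (q ∷ M₁) walk′ b∉W b∉Z eyb ebz)
                (≡.sym (as-bypass [ b ])) q∈H q′∈H (All-bypass M₁ mid∉H b∉H)
                (∈-++⁺ʳ M₁ (there (here refl))) ,
    ≡.subst (length ((q ∷ M₁) ++ y ∷ b ∷ z ∷ (M₃ ∷ʳ q′)) <_) (≡.sym (≡.cong length (as-bypass M₂)))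
      (bypass-shorter G gir (q ∷ M₁) (loop-cycle G (q ∷ M₁) walk′ b∉W b∉Z (sym G ebz) (sym G eyb)))
    where
    as-bypass : ∀ L₂ → q ∷ (M₁ ++ y ∷ L₂ ++ z ∷ M₃) ∷ʳ q′ ≡ (q ∷ M₁) ++ y ∷ L₂ ++ z ∷ (M₃ ∷ʳ q′)
    as-bypass L₂ = ≡.cong (q ∷_) (bypass-++ M₁)
    walk′ = ≡.subst (Walk G (Zs G p)) (as-bypass M₂) walk
    b∉W = b∉Q ∘ ≡.subst (b ∈_) (≡.sym (as-bypass M₂))

  cycle-ear-has-no-bypass : ∀ L₁ {L₂ L₃ y z} → let C = L₁ ++ y ∷ L₂ ++ z ∷ L₃ in
                            EarOK G p (true , C) → b ∉ C → E G y b → E G b z → ⊥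
  cycle-ear-has-no-bypass L₁ {L₂} {L₃} {y} {z} (_ , type1 , type2) b∉C eyb ebz =
    let cyc , shortest = type2 no-one-meet in <⇒≱ (bypass<C cyc) (shortest _ (bypass cyc))
    where
    Zp = Zs G p
    bypass : IsCycleAvoid G Zp (L₁ ++ y ∷ L₂ ++ z ∷ L₃) → IsCycleAvoid G Zp (L₁ ++ y ∷ b ∷ z ∷ L₃)
    bypass cyc = bypass-cycle G L₁ cyc b∉C b∉Z eyb ebz
    loop : IsCycleAvoid G Zp (L₁ ++ y ∷ L₂ ++ z ∷ L₃) → IsCycleAvoid G Zp (z ∷ b ∷ y ∷ L₂)
    loop cyc = loop-cycle G L₁ (IsCycleAvoid⇒Walk G cyc) b∉C b∉Z (sym G ebz) (sym G eyb)
    bypass<C = bypass-shorter G gir L₁ ∘ loop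
    loop<C = loop-shorter G gir L₁ ∘ bypass
    meets-only : ∀ {xs v} → IsCycleAvoid G Zp xs → v ∈ xs → VH p v → All (λ w → VH p w → w ≡ v) xs →
                 OneMeetCycle G p xs
    meets-only cyc v∈ v∈H only = cyc , _ , v∈ , v∈H , λ w w∈ → All.lookup only w∈
    no-one-meet : ¬ (∃[ ys ] OneMeetCycle G p ys)
    no-one-meet ex with (cyc , v , v∈C , v∈H , only) , shortest ← type1 ex
      with only′ ← All.tabulate {P = λ w → VH p w → w ≡ v} (only _)
      with ∈-bypass-or-loop {b = b} L₁ v∈C
    ... | inj₁ v∈B =
      <⇒≱ (bypass<C cyc)
          (shortest _ (meets-only (bypass cyc) v∈B v∈H (All-bypass L₁ only′ (⊥-elim ∘ b∉H))))
    ... | inj₂ v∈D =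
      <⇒≱ (loop<C cyc)
          (shortest _ (meets-only (loop cyc) v∈D v∈H (All-loop L₁ only′ (⊥-elim ∘ b∉H))))

  new-vertices-no-common-neighbour : ∀ {e y z} → EarOK G p e → b ∉ proj₂ e → y ≢ z →
                                     y ∈ proj₂ e → z ∈ proj₂ e → ¬ VH p y → ¬ VH p z →
                                     E G b y → E G b z → ⊥
  new-vertices-no-common-neighbour {true , C} ok b∉C y≢z y∈ z∈ _ _ eby ebz
    with split-∈-∈ C y∈ z∈ y≢z
  ... | inj₁ (L₁ , _ , _ , refl) = cycle-ear-has-no-bypass L₁ ok b∉C (sym G eby) ebz
  ... | inj₂ (L₁ , _ , _ , refl) = cycle-ear-has-no-bypass L₁ ok b∉C (sym G ebz) eby
  new-vertices-no-common-neighbour {false , _}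
    ((pa , (q , mid , q′ , refl , q∈H , q′∈H , mid∉H) , _) , shortest) b∉Q y≢z y∈ z∈ y∉H z∉H eby ebz
    with split-∈-∈ mid (∈-interior q mid q∈H q′∈H y∉H y∈) (∈-interior q mid q∈H q′∈H z∉H z∈) y≢z
  ... | inj₁ (M₁ , _ , _ , refl) =
    let Q′ , hp , lt = shorter-HPath-via-bypass q M₁ pa q∈H q′∈H mid∉H b∉Q (sym G eby) ebz
    in <⇒≱ lt (shortest Q′ hp)
  ... | inj₂ (M₁ , _ , _ , refl) =
    let Q′ , hp , lt = shorter-HPath-via-bypass q M₁ pa q∈H q′∈H mid∉H b∉Q (sym G ebz) eby
    in <⇒≱ lt (shortest Q′ hp)

  new-vertex-in-Y : ∀ {e x y z} → MinDegree≥2 p → EarOK G p e → x ≢ y → VH p x → VH p y →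
                    ¬ Zs G p x → ¬ Zs G p y → E G b x → E G b y → z ∈ proj₂ e → ¬ VH p z →
                    ¬ ¬ Ys (p ∷ʳ e) z
  new-vertex-in-Y {e} {x} {y} {z} deg ok x≢y x∈H y∈H x∉Z y∉Z ebx eby = through-Y e ok
    where
    x-b-y : HPath G p (x ∷ b ∷ y ∷ [])
    x-b-y = HPath-intro G (s≤s (s≤s z≤n) , uniq , sym G ebx ∷ eby ∷ [-] , x∉Z ∷ b∉Z ∷ y∉Z ∷ [])
                        refl x∈H y∈H (b∉H ∷ []) (here refl)
      where
      uniq : Unique (x ∷ b ∷ y ∷ [])
      uniq = ((λ { refl → b∉H x∈H }) ∷ x≢y ∷ []) ∷ ((λ { refl → b∉H y∈H }) ∷ []) ∷ [] ∷ []
    through-Y : ∀ e → EarOK G p e → z ∈ proj₂ e → ¬ VH p z → ¬ ¬ Ys (p ∷ʳ e) z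
    through-Y (true , _) (no-H-path , _) _ _ _ = no-H-path _ x-b-y
    through-Y (false , _) ((_ , (q , mid , q′ , refl , q∈H , q′∈H , _) , _) , shortest) z∈Q z∉H
      with mid | ∈-interior q mid q∈H q′∈H z∉H z∈Q | shortest _ x-b-y
    ... | _ ∷ []        | here refl | _ = ¬¬-map degree-3 (deg q q∈H)
      where
      qz : EH (p ∷ʳ (false , q ∷ z ∷ q′ ∷ [])) q z
      qz = Any-++⁺ʳ p (here (inj₁ here))
      degree-3 : TwoNeighbours (EH p) q → Ys (p ∷ʳ (false , q ∷ z ∷ q′ ∷ [])) z
      degree-3 (two-neighbours qw₁ qw₂ w₁≢w₂) =
        step (here (_ , _ , _ , Any-++⁺ˡ qw₁ , Any-++⁺ˡ qw₂ , qz , w₁≢w₂ , ≢z qw₁ , ≢z qw₂)) qz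
        where
        ≢z : ∀ {w} → EH p q w → w ≢ z
        ≢z qw refl = z∉H (proj₂ (EH⇒VH qw))
    ... | _ ∷ _ ∷ []    | _ | s≤s (s≤s (s≤s ()))
    ... | _ ∷ _ ∷ _ ∷ _ | _ | s≤s (s≤s (s≤s ()))

module _ {n : ℕ} (G : Graph n) (gir : Girth≥5 G) {es : List (Ear {n})} (ok : EarsOK G es) {b : Fin n}
         (b∉H : ¬ VH es b) (b∉Z : ¬ Zs G es b) where

  Attachment : Fin n → Set
  Attachment s = VH es s × ¬ Zs G es s × E G b s

  private
    All3 : Fin n → Fin n → Fin n → List (Ear {n}) → Set
    All3 s₁ s₂ s₃ p = VH p s₁ × VH p s₂ × VH p s₃

  module _ {p : List (Ear {n})} {e rest} (es≡ : es ≡ p ++ e ∷ rest) where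

    private
      p∷ʳe⊆es : p ∷ʳ e ⊆ es
      p∷ʳe⊆es = ≡.subst (p ∷ʳ e ⊆_) (≡.sym (≡.trans es≡ (≡.sym (++-assoc p [ e ] rest))))
                        (xs⊆xs++ys (p ∷ʳ e) rest)
      p⊆es : p ⊆ es
      p⊆es = p∷ʳe⊆es ∘ ∈-++⁺ˡ
      in-new-ear : ∀ {v} → VH (p ∷ʳ e) v → ¬ VH p v → v ∈ proj₂ e
      in-new-ear v∈ v∉p with Any-++⁻ p v∈
      ... | inj₁ v∈p        = ⊥-elim (v∉p v∈p)
      ... | inj₂ (here v∈e) = v∈e
      b∉Hp = b∉H ∘ Any-resp-⊆ p⊆es
      b∉Zp = ¬Zs-⊆-outside G p⊆es b∉H b∉Z

    old-old-new : ∀ {x y z} → x ≢ y → Attachment x → Attachment y → Attachment z →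
                  VH p x → VH p y → ¬ VH p z → VH (p ∷ʳ e) z → ⊥
    old-old-new x≢y (_ , x∉Z , ebx) (_ , y∉Z , eby) (_ , z∉Z , _) x∈p y∈p z∉p z∈ =
      new-vertex-in-Y G gir b∉Hp b∉Zp deg (ok p e rest es≡) x≢y x∈p y∈p
        (¬Zs-⊆ G p⊆es x∈p x∉Z) (¬Zs-⊆ G p⊆es y∈p y∉Z) ebx eby (in-new-ear z∈ z∉p) z∉p
        (z∉Z ∘ here ∘ Ys-mono p∷ʳe⊆es)
      where
      deg = EarsOK⇒MinDegree≥2 G (EarsOK-++⁻ˡ G p (≡.subst (EarsOK G) es≡ ok))

    new-new : ∀ {y z} → y ≢ z → Attachment y → Attachment z →
              ¬ VH p y → ¬ VH p z → VH (p ∷ʳ e) y → VH (p ∷ʳ e) z → ⊥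
    new-new y≢z (_ , _ , eby) (_ , _ , ebz) y∉p z∉p y∈ z∈ =
      new-vertices-no-common-neighbour G gir b∉Hp b∉Zp (ok p e rest es≡)
        (b∉H ∘ Any-resp-⊆ p∷ʳe⊆es ∘ Any-++⁺ʳ p ∘ here) y≢z (in-new-ear y∈ y∉p) (in-new-ear z∈ z∉p)
        y∉p z∉p eby ebz

  three-attachments-impossible : ∀ {s₁ s₂ s₃} → s₁ ≢ s₂ → s₁ ≢ s₃ → s₂ ≢ s₃ →
                                 Attachment s₁ → Attachment s₂ → Attachment s₃ → ⊥
  three-attachments-impossible {s₁} {s₂} {s₃} d₁₂ d₁₃ d₂₃ a₁ a₂ a₃ =
    prefix-induction (¬_ ∘ All3 s₁ s₂ s₃) es (λ { (() , _) }) not-all-yet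
                     (proj₁ a₁ , proj₁ a₂ , proj₁ a₃)
    where
    not-all-yet : ∀ p e rest → es ≡ p ++ e ∷ rest → ¬ All3 s₁ s₂ s₃ p → ¬ All3 s₁ s₂ s₃ (p ∷ʳ e)
    not-all-yet p e rest es≡ ¬all (h₁ , h₂ , h₃) with VH? p s₁ | VH? p s₂ | VH? p s₃
    ... | yes o₁ | yes o₂ | yes o₃ = ¬all (o₁ , o₂ , o₃)
    ... | yes o₁ | yes o₂ | no  n₃ = old-old-new es≡ d₁₂ a₁ a₂ a₃ o₁ o₂ n₃ h₃
    ... | yes o₁ | no  n₂ | yes o₃ = old-old-new es≡ d₁₃ a₁ a₃ a₂ o₁ o₃ n₂ h₂
    ... | no  n₁ | yes o₂ | yes o₃ = old-old-new es≡ d₂₃ a₂ a₃ a₁ o₂ o₃ n₁ h₁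
    ... | _      | no  n₂ | no  n₃ = new-new es≡ d₂₃ a₂ a₃ n₂ n₃ h₂ h₃
    ... | no  n₁ | _      | no  n₃ = new-new es≡ d₁₃ a₁ a₃ n₁ n₃ h₁ h₃
    ... | no  n₁ | no  n₂ | _      = new-new es≡ d₁₂ a₁ a₂ n₁ n₂ h₁ h₂

-- Edges from H to the interior of the last ear

module _ {n : ℕ} (G : Graph n) {es : List (Ear {n})} {q q′ b : Fin n} where

  ShortestEarThrough : List (Fin n) → List (Fin n) → Set
  ShortestEarThrough M₁ M₂ =
    IsPathAvoid G (Zs G es) (q ∷ (M₁ ++ b ∷ M₂) ∷ʳ q′) × All (λ v → ¬ VH es v) (M₁ ++ b ∷ M₂) ×
    (∀ ys → HPath G es ys → length (q ∷ (M₁ ++ b ∷ M₂) ∷ʳ q′) ≤ length ys)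

  module _ {a} (q∈H : VH es q) (q′∈H : VH es q′) (a∈H : VH es a) (eab : E G a b) where

    module _ M₁ {M₂} (ear : ShortestEarThrough M₁ M₂) where

      b∉H : ¬ VH es b
      b∉H = All.lookup (proj₁ (proj₂ ear)) (∈-++⁺ʳ M₁ (here refl))

      b∉Z : ¬ Zs G es b
      b∉Z = All.lookup (proj₂ (proj₂ (proj₂ (proj₁ ear)))) (there (∈-++⁺ˡ (∈-++⁺ʳ M₁ (here refl))))

      a∉Z : ¬ Zs G es a
      a∉Z = ¬Zs-neighbour G a∈H eab b∉H b∉Z

      a≢b : a ≢ b
      a≢b refl = b∉H a∈H

    a≢q′⇒M₁≡[] : ∀ M₁ M₂ → ShortestEarThrough M₁ M₂ → a ≢ q′ → M₁ ≡ []
    a≢q′⇒M₁≡[] []       _  _ _ = refl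
    a≢q′⇒M₁≡[] (m ∷ M₁) M₂ ear@((_ , walk) , mid∉H , shortest) a≢q′ =
      ⊥-elim (<⇒≱ a-b-path-shorter (shortest _ a-b-path))
      where
      L = q ∷ m ∷ M₁
      T = M₂ ∷ʳ q′
      as-LbT : q ∷ (m ∷ M₁ ++ b ∷ M₂) ∷ʳ q′ ≡ L ++ b ∷ T
      as-LbT = ≡.cong (q ∷_) (++-assoc (m ∷ M₁) (b ∷ M₂) [ q′ ])
      M₂∉H = All-++⁻ʳ (m ∷ M₁) mid∉H
      a∉bT : a ∉ b ∷ T
      a∉bT = ∉-path (a≢b (m ∷ M₁) ear) (λ a∈ → All.lookup (All.tail M₂∉H) a∈ a∈H) a≢q′
      a-b-path : HPath G es (a ∷ b ∷ T)
      a-b-path with u , l , ∉Z ← ≡.subst (Walk G (Zs G es)) as-LbT walk =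
        HPath-intro G (s≤s (s≤s z≤n) , Unique-∷ a∉bT (Unique-++⁻ʳ L u) , eab ∷ Linked-++⁻ʳ L l ,
                       a∉Z (m ∷ M₁) ear ∷ All-++⁻ʳ L ∉Z)
                    refl a∈H q′∈H M₂∉H (here refl)
      a-b-path-shorter : length (a ∷ b ∷ T) < length (q ∷ (m ∷ M₁ ++ b ∷ M₂) ∷ʳ q′)
      a-b-path-shorter = ≡.subst (length (a ∷ b ∷ T) <_) (≡.sym (≡.cong length as-LbT))
                                 (s≤s (s≤s (length-++-≥ʳ M₁)))

    a≢q⇒M₂≡[] : ∀ M₁ M₂ → ShortestEarThrough M₁ M₂ → a ≢ q → M₂ ≡ []
    a≢q⇒M₂≡[] _  []       _ _ = refl
    a≢q⇒M₂≡[] M₁ (m ∷ M₂) ear@((_ , walk) , mid∉H , shortest) a≢q =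
      ⊥-elim (<⇒≱ b-a-path-shorter (shortest _ b-a-path))
      where
      L = q ∷ M₁ ∷ʳ b
      T = m ∷ M₂ ∷ʳ q′
      as-LT : q ∷ (M₁ ++ b ∷ m ∷ M₂) ∷ʳ q′ ≡ L ++ T
      as-LT = ≡.cong (q ∷_) (≡.trans (++-assoc M₁ (b ∷ m ∷ M₂) [ q′ ]) (≡.sym (++-assoc M₁ [ b ] T)))
      M₁b∉H = All-++⁺ (All-++⁻ˡ M₁ mid∉H) (b∉H M₁ ear ∷ [])
      a∉L : a ∉ L
      a∉L = ∉-path a≢q (λ a∈ → All.lookup (All-++⁻ˡ M₁ mid∉H) a∈ a∈H) (a≢b M₁ ear)
      b-a-path : HPath G es (L ∷ʳ a)
      b-a-path with u , l , ∉Z ← ≡.subst (Walk G (Zs G es)) as-LT walk =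
        HPath-intro G (s≤s (length-++-≥ʳ (M₁ ∷ʳ b)) , Unique-∷ʳ a∉L (Unique-++⁻ˡ L u) ,
                       Linked-∷ʳ (q ∷ M₁) (Linked-++⁻ˡ L l) (sym G eab) ,
                       All-++⁺ (All-++⁻ˡ L ∉Z) (a∉Z M₁ ear ∷ []))
                    refl q∈H a∈H M₁b∉H (∈-++⁺ʳ M₁ (here refl))
      b-a-path-shorter : length (L ∷ʳ a) < length (q ∷ (M₁ ++ b ∷ m ∷ M₂) ∷ʳ q′)
      b-a-path-shorter =
        ≡.subst₂ _<_ (≡.sym (length-++ L)) (≡.sym (≡.trans (≡.cong length as-LT) (length-++ L)))
                 (+-monoʳ-< (length L) (s≤s (length-++-≥ʳ M₂)))

    no-chord-to-interior : Girth≥5 G → EarsOK G es → ∀ M₁ M₂ → ShortestEarThrough M₁ M₂ →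
                           ¬ EdgeOf (q ∷ (M₁ ++ b ∷ M₂) ∷ʳ q′) a b → ⊥
    no-chord-to-interior gir ok M₁ M₂ ear@((_ , uq , l , ∉Z) , _) ab∉P with a ≟ q | a ≟ q′
    ... | yes refl | _ with refl ← a≢q′⇒M₁≡[] M₁ M₂ ear (ends-distinct uq) = ab∉P (inj₁ here)
    ... | no a≢q | yes refl with refl ← a≢q⇒M₂≡[] M₁ M₂ ear a≢q = ab∉P (inj₂ (Consec-∷ʳ-∷ʳ (q ∷ M₁)))
    ... | no a≢q | no a≢q′ with refl ← a≢q′⇒M₁≡[] M₁ M₂ ear a≢q′ | refl ← a≢q⇒M₂≡[] M₁ M₂ ear a≢q
      with eqb ∷ ebq′ ∷ [-] ← l | q∉Z ∷ _ ∷ q′∉Z ∷ [] ← ∉Z =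
      three-attachments-impossible G gir ok (b∉H [] ear) (b∉Z [] ear)
        a≢q a≢q′ (ends-distinct {mid = [ b ]} uq)
        (a∈H , a∉Z [] ear , sym G eab) (q∈H , q∉Z , sym G eqb) (q′∈H , q′∉Z , ebq′)

lemma3p7 : ∀ {n : ℕ} (G : Graph n) → Girth≥5 G
    → (es : List Ear) (xs : List (Fin n))
    → CoarseEarDecomp G (es ∷ʳ (false , xs))
    → ∀ (a b : Fin n) → E G a b → ¬ EH (es ∷ʳ (false , xs)) a b
    → VH es a → b ∈ xs
    → (∀ (a′ : Fin n) (mid : List (Fin n)) (b′ : Fin n) → xs ≡ a′ ∷ mid ∷ʳ b′ → b ≢ a′ × b ≢ b′)
    → ⊥
lemma3p7 G gir es xs (_ , ok) a b eab ab∉P a∈H b∈xs b-interior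
  with (pa , (q , mid , q′ , refl , q∈H , q′∈H , mid∉H) , _) , shortest ← ok es (false , xs) [] refl
  with b≢q , b≢q′ ← b-interior q mid q′ refl
  with M₁ , M₂ , refl ← ∈-∃++ (∈-interior {P = b ≢_} q mid b≢q b≢q′ (λ b≢b → b≢b refl) b∈xs) =
  no-chord-to-interior G q∈H q′∈H a∈H eab gir (EarsOK-++⁻ˡ G es ok) M₁ M₂
    (pa , mid∉H , shortest) (ab∉P ∘ Any-++⁺ʳ es ∘ here)
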